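{- Let $i,j$ be positive integers and $D$ an $(i,j)$ digraph. Suppose that a vertex $u$ has exactly $ij$ neighbors in $P(D)$, and let $D'$ be the subdigraph of $D$ induced by $u$ and these $ij$ neighbors. If $u$ is a source of $D'$, then: (1) $u$ has outdegree $j$ in $D'$; (2) each out-neighbor $v$ of $u$ has indegree $i$ in $D'$ and $N^-_D(v)\cap N^+_D(u)=\emptyset$; (3) $N^-_D(v)\cap N^-_D(w) = \{u\}$ for each pair $\{v,w\}$ of distinct out-neighbors of $u$.
   Context: An $(i,j)$ digraph is an acyclic digraph in which every vertex has indegree at most $i$ and outdegree at most $j$. The phylogeny graph $P(D)$ has vertex set $V(D)$ and an edge between distinct $u,v$ iff $(u,v)\in A(D)$ or $(v,u)\in A(D)$ or $u,v$ have a common out-neighbor in $D$. A source is a vertex of indegree $0$. $N^+_D(x)$ and $N^-_D(x)$ denote the out- and in-neighborhoods of $x$ in $D$. -}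

module Defs where

open import Data.Nat using (ℕ; zero; suc; _≤_)
open import Data.Bool using (Bool; true; false; _∧_; _∨_; not; T)
open import Data.Fin using (Fin; _≟_)
open import Data.List using (List; length; filter; allFin)
open import Data.Bool.ListAction using (any)
open import Data.Product using (_×_)
open import Relation.Nullary using (¬_)
open import Relation.Nullary.Decidable using (⌊_⌋; T?)

Digraph : ℕ → Set
Digraph n = Fin n → Fin n → Bool

Arc : ∀ {n} → Digraph n → Fin n → Fin n → Set
Arc D u v = T (D u v)

#[_] : ∀ {n} → (Fin n → Bool) → ℕ
#[_] {n} P = length (filter (λ x → T? (P x)) (allFin n))

data Walk {n} (D : Digraph n) : ℕ → Fin n → Fin n → Set where
  stop : ∀ {u} → Walk D zero u u
  step : ∀ {k u w v} → Arc D u w → Walk D k w v → Walk D (suc k) u v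

Acyclic : ∀ {n} → Digraph n → Set
Acyclic D = ∀ k v → ¬ Walk D (suc k) v v

indeg : ∀ {n} → Digraph n → Fin n → ℕ
indeg D v = #[ (λ w → D w v) ]

outdeg : ∀ {n} → Digraph n → Fin n → ℕ
outdeg D v = #[ (λ w → D v w) ]

IJDigraph : ℕ → ℕ → ∀ {n} → Digraph n → Set
IJDigraph i j D = Acyclic D × (∀ v → indeg D v ≤ i) × (∀ v → outdeg D v ≤ j)

phyAdj : ∀ {n} → Digraph n → Fin n → Fin n → Bool
phyAdj {n} D u v =
  not ⌊ u ≟ v ⌋ ∧ (D u v ∨ D v u ∨ any (λ w → D u w ∧ D v w) (allFin n))

phyDeg : ∀ {n} → Digraph n → Fin n → ℕ
phyDeg D u = #[ phyAdj D u ]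

inD' : ∀ {n} → Digraph n → Fin n → Fin n → Bool
inD' D u x = ⌊ x ≟ u ⌋ ∨ phyAdj D u x

induced : ∀ {n} → Digraph n → (Fin n → Bool) → Digraph n
induced D S x y = S x ∧ S y ∧ D x y

{-# OPTIONS --safe #-}

-- Charge each vertex x ≠ u one unit for an arc u → x and one unit for every
-- common out-neighbour of u and x. A source of D' is a source of D, since every
-- in-neighbour of u lies in D'; so every neighbour of u in P(D) is charged at
-- least once, while the total charge is
-- outdeg u + Σ_{u → w} (indeg w − 1) ≤ j + j (i − 1) = i j.
-- With exactly i j neighbours all these inequalities are tight: every vertex is
-- charged at most once, outdeg u = j and indeg w = i for each out-neighbour w.
module Submission where

open import Defs
open import Data.Nat using (ℕ; _*_; _≤_)
open import Data.Fin using (Fin)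
open import Data.Product using (_×_)
open import Relation.Binary.PropositionalEquality using (_≡_; _≢_)
open import Relation.Nullary using (¬_)
open import Function.Bundles using (_⇔_)

open import Data.Bool using (Bool; true; false; _∧_; not; T)
open import Data.Bool.ListAction using (any)
open import Data.Bool.Properties using (T-∧; T-∨)
open import Data.Empty using (⊥-elim)
open import Data.Fin using (zero; suc; _≟_)
open import Data.List using (length; filter; tabulate; allFin)
open import Data.List.Membership.Propositional using (lose)
open import Data.List.Membership.Propositional.Properties using (∈-allFin)
open import Data.List.Relation.Unary.Any using (satisfied)
open import Data.List.Relation.Unary.Any.Properties using (any⁺; any⁻)
open import Data.Nat using (zero; suc; _+_; _<_; z≤n; s≤s; s≤s⁻¹)
open import Data.Nat.Properties
  using ( ≤-refl; ≤-trans; ≤-antisym; ≤-reflexive; ≮⇒≥; <⇒≱; m≤m+n; m≤n+m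
        ; +-comm; +-mono-≤; +-monoʳ-≤; +-mono-<-≤; +-mono-≤-<; +-cancelˡ-≤
        ; *-comm; *-suc; *-mono-≤; *-monoʳ-≤; *-cancelˡ-≤; *-cancelˡ-≡; +-*-semiring
        ; module ≤-Reasoning)
open import Algebra.Properties.Semiring.Sum +-*-semiring
  using (sum-syntax; ∑-distrib-+; ∑-comm; *-distribˡ-sum; *-distribʳ-sum; sum-cong-≗)
open import Data.Product using (_,_; ∃-syntax)
open import Data.Product.Function.NonDependent.Propositional using (_×-⇔_)
open import Data.Sum using (_⊎_; inj₁; inj₂)
open import Data.Sum.Function.Propositional using (_⊎-⇔_)
open import Function using (_∘_; id)
open import Function.Bundles using (mk⇔; module Equivalence)
open import Function.Construct.Composition using (_⇔-∘_)
open import Function.Construct.Identity using (⇔-id)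
open import Relation.Binary.PropositionalEquality using (refl; sym; trans; cong; cong₂; module ≡-Reasoning)
open import Relation.Nullary using (yes; no; contradiction)
open import Relation.Nullary.Decidable using (⌊_⌋; T?; fromWitness)

open Equivalence using (to; from)

𝟙 : Bool → ℕ
𝟙 true  = 1
𝟙 false = 0

𝟙≤1 : ∀ b → 𝟙 b ≤ 1
𝟙≤1 true  = ≤-refl
𝟙≤1 false = z≤n

1≤𝟙 : ∀ {b} → T b → 1 ≤ 𝟙 b
1≤𝟙 {true} _ = ≤-refl

𝟙-≤ : ∀ b {m} → (T b → 1 ≤ m) → 𝟙 b ≤ m
𝟙-≤ true  1≤m = 1≤m _
𝟙-≤ false _   = z≤n

𝟙*-monoʳ-≤ : ∀ b {m n} → (T b → m ≤ n) → 𝟙 b * m ≤ 𝟙 b * n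
𝟙*-monoʳ-≤ true  m≤n = *-monoʳ-≤ 1 (m≤n _)
𝟙*-monoʳ-≤ false _   = z≤n

𝟙*-cancelˡ-≡ : ∀ {b} m n → T b → 𝟙 b * m ≡ 𝟙 b * n → m ≡ n
𝟙*-cancelˡ-≡ {true} m n _ = *-cancelˡ-≡ m n 1

𝟙-split : ∀ a b → 𝟙 (a ∧ not b) + 𝟙 (a ∧ b) ≡ 𝟙 a
𝟙-split true  true  = refl
𝟙-split true  false = refl
𝟙-split false _     = refl

∧-absorbs-implied : ∀ a {b} → (T b → T a) → a ∧ b ≡ b
∧-absorbs-implied true          _   = refl
∧-absorbs-implied false {false} _   = refl
∧-absorbs-implied false {true}  b⇒a = ⊥-elim (b⇒a _)

T-≢ : ∀ {n} {x y : Fin n} → T (not ⌊ x ≟ y ⌋) ⇔ x ≢ y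
T-≢ {x = x} {y} with x ≟ y
... | yes x≡y = mk⇔ (λ ()) (λ x≢y → x≢y x≡y)
... | no  x≢y = mk⇔ (λ _ → x≢y) _

∑-mono-≤ : ∀ {n} {f g : Fin n → ℕ} → (∀ x → f x ≤ g x) → ∑[ x < n ] f x ≤ ∑[ x < n ] g x
∑-mono-≤ {zero}  _   = z≤n
∑-mono-≤ {suc n} f≤g = +-mono-≤ (f≤g zero) (∑-mono-≤ (f≤g ∘ suc))

∑-mono-< : ∀ {n} {f g : Fin n → ℕ} → (∀ x → f x ≤ g x) →
           ∀ {y} → f y < g y → ∑[ x < n ] f x < ∑[ x < n ] g x
∑-mono-< {suc n} f≤g {zero}  fy<gy = +-mono-<-≤ fy<gy (∑-mono-≤ (f≤g ∘ suc))
∑-mono-< {suc n} f≤g {suc y} fy<gy = +-mono-≤-< (f≤g zero) (∑-mono-< (f≤g ∘ suc) fy<gy)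

∑-mono-≤-tight : ∀ {n} {f g : Fin n → ℕ} → (∀ x → f x ≤ g x) →
                 ∑[ x < n ] g x ≤ ∑[ x < n ] f x → ∀ x → f x ≡ g x
∑-mono-≤-tight f≤g ∑g≤∑f x = ≤-antisym (f≤g x) (≮⇒≥ λ fx<gx → <⇒≱ (∑-mono-< f≤g fx<gx) ∑g≤∑f)

term≤∑ : ∀ {n} (f : Fin n → ℕ) y → f y ≤ ∑[ x < n ] f x
term≤∑ f zero    = m≤m+n (f zero) _
term≤∑ f (suc y) = ≤-trans (term≤∑ (f ∘ suc) y) (m≤n+m _ (f zero))

two-terms≤∑ : ∀ {n} (f : Fin n → ℕ) {y z} → y ≢ z → f y + f z ≤ ∑[ x < n ] f x
two-terms≤∑ f {zero}  {zero}  y≢z = contradiction refl y≢z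
two-terms≤∑ f {zero}  {suc z} _   = +-monoʳ-≤ (f zero) (term≤∑ (f ∘ suc) z)
two-terms≤∑ f {suc y} {zero}  _   =
  ≤-trans (≤-reflexive (+-comm (f (suc y)) (f zero))) (+-monoʳ-≤ (f zero) (term≤∑ (f ∘ suc) y))
two-terms≤∑ f {suc y} {suc z} y≢z = ≤-trans (two-terms≤∑ (f ∘ suc) (y≢z ∘ cong suc)) (m≤n+m _ (f zero))

count-tabulate : ∀ {A : Set} {n} (P : A → Bool) (f : Fin n → A) →
                 length (filter (λ x → T? (P x)) (tabulate f)) ≡ ∑[ k < n ] 𝟙 (P (f k))
count-tabulate {n = zero}  P f = refl
count-tabulate {n = suc n} P f with P (f zero)
... | true  = cong suc (count-tabulate P (f ∘ suc))
... | false = count-tabulate P (f ∘ suc)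

#≡∑ : ∀ {n} (P : Fin n → Bool) → #[ P ] ≡ ∑[ x < n ] 𝟙 (P x)
#≡∑ P = count-tabulate P id

#-cong : ∀ {n} {P Q : Fin n → Bool} → (∀ x → P x ≡ Q x) → #[ P ] ≡ #[ Q ]
#-cong {P = P} {Q} P≡Q = trans (#≡∑ P) (trans (sum-cong-≗ (cong 𝟙 ∘ P≡Q)) (sym (#≡∑ Q)))

module _ {n : ℕ} (D : Digraph n) where

  outdeg-induced : ∀ {S u} → T (S u) → (∀ x → Arc D u x → T (S x)) →
                   outdeg (induced D S) u ≡ outdeg D u
  outdeg-induced {S} {u} Su closed = #-cong λ x →
    trans (cong (S u ∧_) (∧-absorbs-implied (S x) (closed x))) (∧-absorbs-implied (S u) λ _ → Su)

  indeg-induced : ∀ {S v} → T (S v) → (∀ x → Arc D x v → T (S x)) →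
                  indeg (induced D S) v ≡ indeg D v
  indeg-induced {S} {v} Sv closed = #-cong λ x →
    trans (cong (S x ∧_) (∧-absorbs-implied (S v) λ _ → Sv)) (∧-absorbs-implied (S x) (closed x))

  CommonOutNeighbour : Fin n → Fin n → Set
  CommonOutNeighbour x y = ∃[ w ] (Arc D x w × Arc D y w)

  T-any-common : ∀ {x y} → T (any (λ w → D x w ∧ D y w) (allFin n)) ⇔ CommonOutNeighbour x y
  T-any-common {x} {y} = mk⇔
    (λ t → let w , xw∧yw = satisfied (any⁻ (λ w → D x w ∧ D y w) (allFin n) t) in w , to T-∧ xw∧yw)
    (λ (w , arcs) → any⁺ _ (lose (∈-allFin w) (from T-∧ arcs)))

  T-phyAdj : ∀ {u x} → T (phyAdj D u x) ⇔
             (u ≢ x × (Arc D u x ⊎ Arc D x u ⊎ CommonOutNeighbour u x))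
  T-phyAdj = (T-≢ ×-⇔ ((⇔-id _ ⊎-⇔ ((⇔-id _ ⊎-⇔ T-any-common) ⇔-∘ T-∨)) ⇔-∘ T-∨)) ⇔-∘ T-∧

  inD'-intro : ∀ {u x} → (x ≢ u → T (phyAdj D u x)) → T (inD' D u x)
  inD'-intro {u} {x} adj with x ≟ u
  ... | yes _   = _
  ... | no  x≢u = adj x≢u

  self∈D' : ∀ {u} → T (inD' D u u)
  self∈D' {u} = inD'-intro {u} λ u≢u → contradiction refl u≢u

  out-neighbour∈D' : ∀ {u x} → Arc D u x → T (inD' D u x)
  out-neighbour∈D' u→x = inD'-intro λ x≢u → from T-phyAdj (x≢u ∘ sym , inj₁ u→x)

  in-neighbour∈D' : ∀ {u x} → Arc D x u → T (inD' D u x)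
  in-neighbour∈D' x→u = inD'-intro λ x≢u → from T-phyAdj (x≢u ∘ sym , inj₂ (inj₁ x→u))

  co-in-neighbour∈D' : ∀ {u v x} → Arc D u v → Arc D x v → T (inD' D u x)
  co-in-neighbour∈D' {v = v} u→v x→v =
    inD'-intro λ x≢u → from T-phyAdj (x≢u ∘ sym , inj₂ (inj₂ (v , u→v , x→v)))

  source-of-induced : ∀ {u} → (∀ w → ¬ Arc (induced D (inD' D u)) w u) → ∀ w → ¬ Arc D w u
  source-of-induced {u} src w w→u = src w (from T-∧ (in-neighbour∈D' w→u , from T-∧ (self∈D' {u} , w→u)))

  module Charge (u : Fin n) where

    link : Fin n → Fin n → ℕ
    link x w = 𝟙 (D u w) * 𝟙 (D x w ∧ not ⌊ x ≟ u ⌋)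

    charge : Fin n → ℕ
    charge x = 𝟙 (D u x) + ∑[ w < n ] link x w

    otherIn : Fin n → ℕ
    otherIn w = ∑[ x < n ] 𝟙 (D x w ∧ not ⌊ x ≟ u ⌋)

    1≤link : ∀ {x w} → x ≢ u → Arc D u w → Arc D x w → 1 ≤ link x w
    1≤link x≢u u→w x→w = *-mono-≤ (1≤𝟙 u→w) (1≤𝟙 (from T-∧ (x→w , from T-≢ x≢u)))

    ∑-charge : ∑[ x < n ] charge x ≡ outdeg D u + ∑[ w < n ] (𝟙 (D u w) * otherIn w)
    ∑-charge = begin
      ∑[ x < n ] charge x
        ≡⟨ ∑-distrib-+ (𝟙 ∘ D u) (λ x → ∑[ w < n ] link x w) ⟩
      ∑[ x < n ] 𝟙 (D u x) + ∑[ x < n ] ∑[ w < n ] link x w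
        ≡⟨ cong₂ _+_ (sym (#≡∑ (D u))) (∑-comm link) ⟩
      outdeg D u + ∑[ w < n ] ∑[ x < n ] link x w
        ≡⟨ cong (outdeg D u +_) (sum-cong-≗ λ w → sym (*-distribˡ-sum (𝟙 (D u w)) λ x → 𝟙 (D x w ∧ not ⌊ x ≟ u ⌋))) ⟩
      outdeg D u + ∑[ w < n ] (𝟙 (D u w) * otherIn w)
        ∎
      where open ≡-Reasoning

    suc-otherIn≤indeg : ∀ {w} → Arc D u w → suc (otherIn w) ≤ indeg D w
    suc-otherIn≤indeg {w} u→w = begin
      suc (otherIn w)
        ≡⟨ +-comm 1 (otherIn w) ⟩
      otherIn w + 1
        ≤⟨ +-monoʳ-≤ (otherIn w) (≤-trans (1≤𝟙 (from T-∧ (u→w , fromWitness refl))) (term≤∑ fromU u)) ⟩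
      otherIn w + ∑[ x < n ] fromU x
        ≡⟨ sym (∑-distrib-+ _ fromU) ⟩
      ∑[ x < n ] (𝟙 (D x w ∧ not ⌊ x ≟ u ⌋) + fromU x)
        ≡⟨ sum-cong-≗ (λ x → 𝟙-split (D x w) ⌊ x ≟ u ⌋) ⟩
      ∑[ x < n ] 𝟙 (D x w)
        ≡⟨ sym (#≡∑ (λ x → D x w)) ⟩
      indeg D w
        ∎
      where
      open ≤-Reasoning
      fromU : Fin n → ℕ
      fromU x = 𝟙 (D x w ∧ ⌊ x ≟ u ⌋)

    phyAdj≤charge : (∀ x → ¬ Arc D x u) → ∀ x → 𝟙 (phyAdj D u x) ≤ charge x
    phyAdj≤charge source x = 𝟙-≤ (phyAdj D u x) (charged ∘ to T-phyAdj)
      where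
      charged : u ≢ x × (Arc D u x ⊎ Arc D x u ⊎ CommonOutNeighbour u x) → 1 ≤ charge x
      charged (_   , inj₁ u→x)                        = ≤-trans (1≤𝟙 u→x) (m≤m+n _ _)
      charged (_   , inj₂ (inj₁ x→u))                 = contradiction x→u (source x)
      charged (u≢x , inj₂ (inj₂ (w , u→w , x→w))) =
        ≤-trans (1≤link (u≢x ∘ sym) u→w x→w) (≤-trans (term≤∑ (link x) w) (m≤n+m _ _))

module Extremal (k j : ℕ) {n : ℕ} (D : Digraph n)
                (indeg≤ : ∀ v → indeg D v ≤ suc k) (outdeg≤ : ∀ v → outdeg D v ≤ j)
                (u : Fin n) (deg : phyDeg D u ≡ suc k * j) (source : ∀ x → ¬ Arc D x u) where

  open Charge D u

  private
    d : ℕ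
    d = outdeg D u

    E : ℕ
    E = ∑[ w < n ] (𝟙 (D u w) * otherIn w)

  otherIn-term≤ : ∀ w → 𝟙 (D u w) * otherIn w ≤ 𝟙 (D u w) * k
  otherIn-term≤ w = 𝟙*-monoʳ-≤ (D u w) λ u→w → s≤s⁻¹ (≤-trans (suc-otherIn≤indeg u→w) (indeg≤ w))

  ∑-term≡d*k : ∑[ w < n ] (𝟙 (D u w) * k) ≡ d * k
  ∑-term≡d*k = trans (sym (*-distribʳ-sum k (𝟙 ∘ D u))) (cong (_* k) (sym (#≡∑ (D u))))

  ∑charge≤suc[k]*d : ∑[ x < n ] charge x ≤ suc k * d
  ∑charge≤suc[k]*d = begin
    ∑[ x < n ] charge x ≡⟨ ∑-charge ⟩
    d + E               ≤⟨ +-monoʳ-≤ d (≤-trans (∑-mono-≤ otherIn-term≤) (≤-reflexive ∑-term≡d*k)) ⟩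
    d + d * k           ≡⟨ sym (*-suc d k) ⟩
    d * suc k           ≡⟨ *-comm d (suc k) ⟩
    suc k * d           ∎
    where open ≤-Reasoning

  suc[k]*j≤∑charge : suc k * j ≤ ∑[ x < n ] charge x
  suc[k]*j≤∑charge = begin
    suc k * j                         ≡⟨ sym deg ⟩
    phyDeg D u                        ≡⟨ #≡∑ (phyAdj D u) ⟩
    ∑[ x < n ] 𝟙 (phyAdj D u x)       ≤⟨ ∑-mono-≤ (phyAdj≤charge source) ⟩
    ∑[ x < n ] charge x               ∎
    where open ≤-Reasoning

  outdeg≡j : outdeg D u ≡ j
  outdeg≡j = ≤-antisym (outdeg≤ u) (*-cancelˡ-≤ (suc k) (≤-trans suc[k]*j≤∑charge ∑charge≤suc[k]*d))

  charge≤1 : ∀ x → charge x ≤ 1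
  charge≤1 x = ≤-trans (≤-reflexive (sym (phyAdj≡charge x))) (𝟙≤1 (phyAdj D u x))
    where
    phyAdj≡charge : ∀ x → 𝟙 (phyAdj D u x) ≡ charge x
    phyAdj≡charge = ∑-mono-≤-tight (phyAdj≤charge source) (begin
      ∑[ x < n ] charge x            ≤⟨ ∑charge≤suc[k]*d ⟩
      suc k * d                      ≤⟨ *-mono-≤ (≤-refl {suc k}) (outdeg≤ u) ⟩
      suc k * j                      ≡⟨ deg ⟨
      phyDeg D u                     ≡⟨ #≡∑ (phyAdj D u) ⟩
      ∑[ x < n ] 𝟙 (phyAdj D u x)    ∎)
      where open ≤-Reasoning

  indeg≡suc[k] : ∀ {w} → Arc D u w → indeg D w ≡ suc k
  indeg≡suc[k] {w} u→w = ≤-antisym (indeg≤ w) (≤-trans (≤-reflexive (cong suc (sym otherIn≡k))) (suc-otherIn≤indeg u→w))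
    where
    d*k≤E : d * k ≤ E
    d*k≤E = +-cancelˡ-≤ d _ _ (begin
      d + d * k   ≡⟨ *-suc d k ⟨
      d * suc k   ≡⟨ *-comm d (suc k) ⟩
      suc k * d   ≡⟨ cong (suc k *_) outdeg≡j ⟩
      suc k * j   ≤⟨ suc[k]*j≤∑charge ⟩
      ∑[ x < n ] charge x  ≡⟨ ∑-charge ⟩
      d + E       ∎)
      where open ≤-Reasoning

    otherIn≡k : otherIn w ≡ k
    otherIn≡k = 𝟙*-cancelˡ-≡ (otherIn w) k u→w
      (∑-mono-≤-tight otherIn-term≤ (≤-trans (≤-reflexive ∑-term≡d*k) d*k≤E) w)

  two≰charge : ∀ x → ¬ 2 ≤ charge x
  two≰charge x 2≤charge with ≤-trans 2≤charge (charge≤1 x)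
  ... | s≤s ()

  no-out-neighbour-into-out-neighbour : ∀ {v w} → Arc D u v → Arc D w v → ¬ Arc D u w
  no-out-neighbour-into-out-neighbour {v} {w} u→v w→v u→w = two≰charge w
    (+-mono-≤ (1≤𝟙 u→w) (≤-trans (1≤link w≢u u→v w→v) (term≤∑ (link w) v)))
    where
    w≢u : w ≢ u
    w≢u refl = source u u→w

  common-in-neighbour≡u : ∀ {v w x} → Arc D u v → Arc D u w → v ≢ w →
                          Arc D x v → Arc D x w → x ≡ u
  common-in-neighbour≡u {v} {w} {x} u→v u→w v≢w x→v x→w with x ≟ u
  ... | yes x≡u = x≡u
  ... | no  x≢u = contradiction
    (≤-trans (+-mono-≤ (1≤link x≢u u→v x→v) (1≤link x≢u u→w x→w))
      (≤-trans (two-terms≤∑ (link x) v≢w) (m≤n+m _ (𝟙 (D u x)))))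
    (two≰charge x)

lemma3p8 : (i j : ℕ) → 1 ≤ i → 1 ≤ j → {n : ℕ} → (D : Digraph n) → IJDigraph i j D →
           (u : Fin n) → phyDeg D u ≡ i * j →
           (∀ w → ¬ Arc (induced D (inD' D u)) w u) →
           (outdeg (induced D (inD' D u)) u ≡ j)
           × (∀ v → Arc D u v →
                (indeg (induced D (inD' D u)) v ≡ i)
                × (∀ w → ¬ (Arc D w v × Arc D u w)))
           × (∀ v w → Arc D u v → Arc D u w → v ≢ w →
                ∀ x → (Arc D x v × Arc D x w) ⇔ (x ≡ u))
lemma3p8 (suc k) j _ _ D (_ , indeg≤ , outdeg≤) u deg sourceInD' =
    trans (outdeg-induced D (self∈D' D {u}) λ _ → out-neighbour∈D' D) outdeg≡j
  , (λ v u→v → trans (indeg-induced D (out-neighbour∈D' D u→v) λ _ → co-in-neighbour∈D' D u→v)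
                     (indeg≡suc[k] u→v)
             , λ w (w→v , u→w) → no-out-neighbour-into-out-neighbour u→v w→v u→w)
  , λ v w u→v u→w v≢w x → mk⇔ (λ (x→v , x→w) → common-in-neighbour≡u u→v u→w v≢w x→v x→w)
                              λ { refl → u→v , u→w }
  where open Extremal k j D indeg≤ outdeg≤ u deg (source-of-induced D sourceInD')
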